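{- Let $D=(V,A)$ be a digraph. Then, with all sums over ordered partitions $R\uplus S\uplus T=A$ of the arc set into three (possibly empty) disjoint subsets, $$\sum_{R\uplus S\uplus T=A} y^{|S|}z^{|T|}\chi^{>}_{D^{ -T}_{\setminus R}}(q)=B_D(q,1+y,1+z),$$ $$\sum_{R\uplus S\uplus T=A} y^{|S|}z^{|T|}\chi^{\geq}_{D^{ -T}_{\setminus R}}(q)=(1+y+z)^{|A|}B_D\!\left(q,\frac{1+y}{1+y+z},\frac{1+z}{1+y+z}\right),$$ $$\sum_{R\uplus S\uplus T=A} y^{|S|}z^{|T|}\chi^{>}_{D^{ -T}_{/R}}(q)=B_D(q,y,z),$$ $$\sum_{R\uplus S\uplus T=A} y^{|S|}z^{|T|}\chi^{\geq}_{D^{ -T}_{/R}}(q)=(1+y+z)^{|A|}B_D\!\left(q,\frac{y}{1+y+z},\frac{z}{1+y+z}\right).$$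
   Context: Digraphs $D=(V,A)$ are finite, loops and multiple arcs allowed. The $B$-polynomial $B_D(q,y,z)$ is the unique polynomial such that for every positive integer $q$, $B_D(q,y,z)=\sum_{f:V\to\{1,\dots,q\}} y^{\#\{(u,v)\in A: f(v)>f(u)\}} z^{\#\{(u,v)\in A: f(v)<f(u)\}}$. The strict-chromatic polynomial $\chi^{>}_D(q)$ is the polynomial whose value at each positive integer $q$ is the number of $f:V\to\{1,\dots,q\}$ with $f(u)<f(v)$ for all $(u,v)\in A$; the weak-chromatic polynomial $\chi^{\geq}_D(q)$ counts those with $f(u)\le f(v)$ for all $(u,v)\in A$. For disjoint $R,T\subseteq A$, $D^{ -T}_{\setminus R}$ is obtained by deleting the arcs of $R$ and reversing the arcs of $T$ (replacing $(u,v)$ by $(v,u)$); $D^{ -T}_{/R}$ is obtained by contracting the arcs of $R$ (removing each and identifying its endpoints) and reversing the arcs of $T$. -}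

module Defs where

open import Data.Nat as ℕ using (ℕ; zero; suc; _<ᵇ_; _≤ᵇ_)
open import Data.Fin using (Fin; zero; suc; toℕ; punchOut; _≟_)
open import Data.Fin.Properties using () renaming (_≟_ to _≟F_)
open import Data.List using (List; []; _∷_; map; concatMap; length; zip; foldr)
open import Data.Bool.ListAction using (and)
open import Data.Nat.ListAction using (sum)
open import Data.Vec using (Vec; []; _∷_; lookup; toList)
open import Data.Product using (Σ; _×_; _,_; proj₁; proj₂)
open import Data.Bool using (Bool; true; false; if_then_else_)
open import Data.Integer using (+_)
open import Data.Rational using (ℚ; 0ℚ; 1ℚ; _+_; _*_; _/_)
open import Relation.Nullary using (yes; no; ¬_)
open import Relation.Binary.PropositionalEquality using (_≡_; refl; sym)
open import Function using (id; _∘_)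

record Digraph : Set where
  constructor digraph
  field
    n    : ℕ
    arcs : List (Fin n × Fin n)
open Digraph public

-- labels of an ordered partition R ⊎ S ⊎ T of the arc set
data Lab : Set where
  R S T : Lab

allVec : {X : Set} → List X → (k : ℕ) → List (Vec X k)
allVec xs zero    = [] ∷ []
allVec xs (suc k) = concatMap (λ c → map (c ∷_) (allVec xs k)) xs

allFin : (q : ℕ) → List (Fin q)
allFin q = Data.List.allFin q

-- all maps V → {1..q} (realised as Fin q with its order)
colourings : (n q : ℕ) → List (Vec (Fin q) n)
colourings n q = allVec (allFin q) n

partitions : (m : ℕ) → List (Vec Lab m)
partitions m = allVec (R ∷ S ∷ T ∷ []) m

count : {X : Set} → (X → Bool) → List X → ℕ
count p xs = sum (map (λ x → if p x then 1 else 0) xs)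

χ> : Digraph → ℕ → ℕ
χ> D q = count (λ f → and (map (λ a → toℕ (lookup f (proj₁ a)) <ᵇ toℕ (lookup f (proj₂ a))) (arcs D)))
               (colourings (n D) q)

χ≥ : Digraph → ℕ → ℕ
χ≥ D q = count (λ f → and (map (λ a → toℕ (lookup f (proj₁ a)) ≤ᵇ toℕ (lookup f (proj₂ a))) (arcs D)))
               (colourings (n D) q)

ℕ→ℚ : ℕ → ℚ
ℕ→ℚ k = (+ k) / 1

_^_ : ℚ → ℕ → ℚ
x ^ zero  = 1ℚ
x ^ suc k = x * (x ^ k)

sumℚ : List ℚ → ℚ
sumℚ = foldr _+_ 0ℚ

B : Digraph → ℕ → ℚ → ℚ → ℚ
B D q y z = sumℚ (map (λ f → (y ^ asc f) * (z ^ desc f)) (colourings (n D) q))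
  where
  asc : Vec (Fin q) (n D) → ℕ
  asc f = count (λ a → toℕ (lookup f (proj₁ a)) <ᵇ toℕ (lookup f (proj₂ a))) (arcs D)
  desc : Vec (Fin q) (n D) → ℕ
  desc f = count (λ a → toℕ (lookup f (proj₂ a)) <ᵇ toℕ (lookup f (proj₁ a))) (arcs D)

labelled : (D : Digraph) → Vec Lab (length (arcs D)) → List (Lab × Fin (n D) × Fin (n D))
labelled D ls = zip (toList ls) (arcs D)

numLab : Lab → {X : Set} → List (Lab × X) → ℕ
numLab R = count (λ p → isR (proj₁ p)) where
  isR : Lab → Bool
  isR R = true
  isR _ = false
numLab S = count (λ p → isS (proj₁ p)) where
  isS : Lab → Bool
  isS S = true
  isS _ = false
numLab T = count (λ p → isT (proj₁ p)) where
  isT : Lab → Bool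
  isT T = true
  isT _ = false

orient : {k m : ℕ} → (Fin k → Fin m) → List (Lab × Fin k × Fin k) → List (Fin m × Fin m)
orient π [] = []
orient π ((R , u , v) ∷ as) = orient π as
orient π ((S , u , v) ∷ as) = (π u , π v) ∷ orient π as
orient π ((T , u , v) ∷ as) = (π v , π u) ∷ orient π as

-- D^{-T}_{\R}: delete R, reverse T
delRev : (D : Digraph) → Vec Lab (length (arcs D)) → Digraph
delRev D ls = digraph (n D) (orient id (labelled D ls))

merge : {m : ℕ} (a b : Fin m) → ¬ (a ≡ b) → Σ ℕ (λ m' → Fin m → Fin m')
merge {zero}  () b _
merge {suc k} a b a≢b = k , σ
  where
  σ : Fin (suc k) → Fin k
  σ w with b ≟F w
  ... | yes _   = punchOut {i = b} {j = a} (λ e → a≢b (sym e))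
  ... | no b≢w  = punchOut {i = b} {j = w} b≢w

-- quotient map obtained by contracting a list of arcs one after another
-- (a loop is simply removed; otherwise its endpoints are identified)
quot : (k : ℕ) → List (Fin k × Fin k) → Σ ℕ (λ m → Fin k → Fin m)
quot k [] = k , id
quot k ((u , v) ∷ rs) with quot k rs
... | m , π with π u ≟F π v
...   | yes _ = m , π
...   | no ne with merge (π u) (π v) ne
...     | m' , σ = m' , σ ∘ π

rArcs : {k : ℕ} → List (Lab × Fin k × Fin k) → List (Fin k × Fin k)
rArcs [] = []
rArcs ((R , e) ∷ as) = e ∷ rArcs as
rArcs ((S , e) ∷ as) = rArcs as
rArcs ((T , e) ∷ as) = rArcs as

-- D^{-T}_{/R}: contract R, reverse T
conRev : (D : Digraph) → Vec Lab (length (arcs D)) → Digraph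
conRev D ls with quot (n D) (rArcs (labelled D ls))
... | m , π = digraph m (orient π (labelled D ls))

partSum : (D : Digraph) → ℚ → ℚ → (Vec Lab (length (arcs D)) → ℚ) → ℚ
partSum D y z g = sumℚ (map (λ ls → ((y ^ numLab S (labelled D ls)) * (z ^ numLab T (labelled D ls))) * g ls)
                            (partitions (length (arcs D))))

-- Each chromatic count is a sum over colourings f of a product over the arcs of D: an S arc (u , v)
-- contributes [f u ∼ f v], a T arc [f v ∼ f u], a deleted arc 1, and a contracted arc [f u = f v],
-- because the colourings of a contraction are exactly the colourings that are constant on the
-- contracted arcs.  Exchanging the sum over partitions with the sum over colourings, the sum over
-- R ⊎ S ⊎ T factorises over the arcs into ∏ (r + y s + z t).  Each such factor depends only on
-- whether f u < f v, f u = f v or f u > f v; so does the arc factor of B, and a case check shows that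
-- the two agree (up to the factor 1 + y + z for the weak counts).
module Submission where

open import Defs
open import Data.Nat using (ℕ; _≥_)
open import Data.Product using (_×_)
open import Data.List using (length)
open import Data.Rational using (ℚ; 0ℚ; 1ℚ; _+_; _*_; _÷_; ≢-nonZero)
open import Relation.Nullary using (¬_)
open import Relation.Binary.PropositionalEquality using (_≡_)

open import Algebra.Bundles using (CommutativeMonoid)
open import Data.Bool using (Bool; true; false; not; if_then_else_)
open import Data.Bool.ListAction using (and)
open import Data.Fin using (Fin; zero; suc; toℕ; punchOut)
open import Data.Fin.Properties using (punchIn-punchOut) renaming (_≟_ to _≟ᶠ_)
import Data.Integer as ℤ
open import Data.List using (List; []; _∷_; map; concatMap; _++_; zip)
open import Data.List.Properties using (map-∘; map-tabulate)
open import Data.Nat as ℕ using (zero; suc; _<ᵇ_; _≤ᵇ_; _≡ᵇ_)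
open import Data.Nat.Properties using () renaming (*-identityʳ to ℕ-*-identityʳ)
open import Data.Product using (_,_; proj₁; proj₂; swap)
open import Data.Rational using (NonZero; 1/_; toℚᵘ)
open import Data.Rational.Properties
  using (_≟_; +-*-commutativeRing; *-1-commutativeMonoid; +-0-commutativeMonoid; +-assoc; +-identityˡ;
         +-identityʳ; *-assoc; *-identityˡ; *-identityʳ; *-zeroˡ; *-zeroʳ; *-distribˡ-+; *-distribʳ-+;
         *-inverseʳ; toℚᵘ-injective; toℚᵘ-homo-+; toℚᵘ-fromℚᵘ)
open import Data.Rational.Unnormalised as ℚᵘ using (mkℚᵘ; *≡*; 1ℚᵘ)
import Data.Rational.Unnormalised.Properties as ℚᵘ
open import Data.Vec as Vec using (Vec; lookup; toList; insertAt)
open import Data.Vec.Properties using (insertAt-lookup; insertAt-punchIn)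
open import Function using (_∘_; id; flip)
open import Level using (0ℓ)
open import Relation.Binary.PropositionalEquality
  using (refl; sym; trans; cong; cong₂; _≗_; _≢_; ≢-sym; module ≡-Reasoning)
open import Relation.Binary.Core using (_Preserves_⟶_)
open import Relation.Nullary using (yes; no)
open import Relation.Nullary.Decidable using (dec⇒maybe)
open import Tactic.RingSolver using (solve)
import Tactic.RingSolver.Core.AlmostCommutativeRing as ACR

open import Algebra.Properties.CommutativeSemigroup
  (CommutativeMonoid.commutativeSemigroup *-1-commutativeMonoid)
  using (x∙yz≈y∙xz; x∙yz≈yx∙z) renaming (interchange to *-interchange)
open import Algebra.Properties.CommutativeSemigroup
  (CommutativeMonoid.commutativeSemigroup +-0-commutativeMonoid)
  using () renaming (interchange to +-interchange)

open ≡-Reasoning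

private
  variable
    X Y A : Set
    k m q : ℕ

∑ : List X → (X → ℚ) → ℚ
∑ xs F = sumℚ (map F xs)

syntax ∑ xs (λ x → F) = ∑[ x ← xs ] F

∏ : List X → (X → ℚ) → ℚ
∏ []       F = 1ℚ
∏ (x ∷ xs) F = F x * ∏ xs F

syntax ∏ xs (λ x → F) = ∏[ x ← xs ] F

𝟙 : Bool → ℚ
𝟙 true  = 1ℚ
𝟙 false = 0ℚ

∑-cong : (xs : List X) {F G : X → ℚ} → F ≗ G → ∑ xs F ≡ ∑ xs G
∑-cong []       F≗G = refl
∑-cong (x ∷ xs) F≗G = cong₂ _+_ (F≗G x) (∑-cong xs F≗G)

∑-++ : (xs ys : List X) (F : X → ℚ) → ∑ (xs ++ ys) F ≡ ∑ xs F + ∑ ys F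
∑-++ []       ys F = sym (+-identityˡ _)
∑-++ (x ∷ xs) ys F = trans (cong (F x +_) (∑-++ xs ys F)) (sym (+-assoc (F x) _ _))

∑-map : (g : X → Y) (xs : List X) (F : Y → ℚ) → ∑ (map g xs) F ≡ ∑ xs (F ∘ g)
∑-map g xs F = cong sumℚ (sym (map-∘ xs))

∑-concatMap : (h : X → List Y) (xs : List X) (F : Y → ℚ) → ∑ (concatMap h xs) F ≡ ∑[ x ← xs ] ∑ (h x) F
∑-concatMap h []       F = refl
∑-concatMap h (x ∷ xs) F = trans (∑-++ (h x) _ F) (cong (∑ (h x) F +_) (∑-concatMap h xs F))

*-distribˡ-∑ : (c : ℚ) (xs : List X) (F : X → ℚ) → c * ∑ xs F ≡ ∑[ x ← xs ] (c * F x)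
*-distribˡ-∑ c []       F = *-zeroʳ c
*-distribˡ-∑ c (x ∷ xs) F = trans (*-distribˡ-+ c (F x) _) (cong (c * F x +_) (*-distribˡ-∑ c xs F))

*-distribʳ-∑ : (c : ℚ) (xs : List X) (F : X → ℚ) → ∑ xs F * c ≡ ∑[ x ← xs ] (F x * c)
*-distribʳ-∑ c []       F = *-zeroˡ c
*-distribʳ-∑ c (x ∷ xs) F = trans (*-distribʳ-+ c (F x) _) (cong (F x * c +_) (*-distribʳ-∑ c xs F))

∑-zero : (xs : List X) → ∑[ x ← xs ] 0ℚ ≡ 0ℚ
∑-zero []       = refl
∑-zero (x ∷ xs) = trans (+-identityˡ _) (∑-zero xs)

∑-distrib-+ : (xs : List X) (F G : X → ℚ) → ∑[ x ← xs ] (F x + G x) ≡ ∑ xs F + ∑ xs G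
∑-distrib-+ []       F G = refl
∑-distrib-+ (x ∷ xs) F G =
  trans (cong (F x + G x +_) (∑-distrib-+ xs F G)) (+-interchange (F x) (G x) _ _)

∑-comm : (xs : List X) (ys : List Y) (F : X → Y → ℚ) →
         ∑[ x ← xs ] ∑[ y ← ys ] F x y ≡ ∑[ y ← ys ] ∑[ x ← xs ] F x y
∑-comm []       ys F = sym (∑-zero ys)
∑-comm (x ∷ xs) ys F =
  trans (cong (∑ ys (F x) +_) (∑-comm xs ys F)) (sym (∑-distrib-+ ys (F x) _))

∏-cong : (xs : List X) {F G : X → ℚ} → F ≗ G → ∏ xs F ≡ ∏ xs G
∏-cong []       F≗G = refl
∏-cong (x ∷ xs) F≗G = cong₂ _*_ (F≗G x) (∏-cong xs F≗G)

∏-distrib-* : (xs : List X) (F G : X → ℚ) → ∏ xs F * ∏ xs G ≡ ∏[ x ← xs ] (F x * G x)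
∏-distrib-* []       F G = refl
∏-distrib-* (x ∷ xs) F G =
  trans (*-interchange (F x) _ (G x) _) (cong (F x * G x *_) (∏-distrib-* xs F G))

∏-scale : (c : ℚ) (xs : List X) (F : X → ℚ) → ∏[ x ← xs ] (c * F x) ≡ c ^ length xs * ∏ xs F
∏-scale c []       F = refl
∏-scale c (x ∷ xs) F =
  trans (cong (c * F x *_) (∏-scale c xs F)) (*-interchange c (F x) _ _)

-- The split on k lets the sign of + k compute.
1+k≃suc-k : ∀ k → 1ℚᵘ ℚᵘ.+ mkℚᵘ (ℤ.+ k) 0 ℚᵘ.≃ mkℚᵘ (ℤ.+ suc k) 0
1+k≃suc-k zero    = *≡* refl
1+k≃suc-k (suc k) = *≡* (cong (λ j → ℤ.+ suc (suc j)) (ℕ-*-identityʳ _))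

ℕ→ℚ-suc : ∀ k → ℕ→ℚ (suc k) ≡ 1ℚ + ℕ→ℚ k
ℕ→ℚ-suc k = toℚᵘ-injective (begin-≃
  toℚᵘ (ℕ→ℚ (suc k))         ≈⟨ toℚᵘ-fromℚᵘ (mkℚᵘ (ℤ.+ suc k) 0) ⟩
  mkℚᵘ (ℤ.+ suc k) 0            ≈⟨ 1+k≃suc-k k ⟨
  1ℚᵘ ℚᵘ.+ mkℚᵘ (ℤ.+ k) 0       ≈⟨ ℚᵘ.+-congʳ 1ℚᵘ (toℚᵘ-fromℚᵘ (mkℚᵘ (ℤ.+ k) 0)) ⟨
  toℚᵘ 1ℚ ℚᵘ.+ toℚᵘ (ℕ→ℚ k)   ≈⟨ toℚᵘ-homo-+ 1ℚ (ℕ→ℚ k) ⟨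
  toℚᵘ (1ℚ + ℕ→ℚ k)           ∎≃)
  where open ℚᵘ.≃-Reasoning renaming (begin_ to begin-≃_; _∎ to _∎≃)

ℕ→ℚ-count : (p : X → Bool) (xs : List X) → ℕ→ℚ (count p xs) ≡ ∑[ x ← xs ] 𝟙 (p x)
ℕ→ℚ-count p []       = refl
ℕ→ℚ-count p (x ∷ xs) with p x
... | true  = trans (ℕ→ℚ-suc (count p xs)) (cong (1ℚ +_) (ℕ→ℚ-count p xs))
... | false = trans (ℕ→ℚ-count p xs) (sym (+-identityˡ _))

𝟙-and : (p : X → Bool) (xs : List X) → 𝟙 (and (map p xs)) ≡ ∏[ x ← xs ] 𝟙 (p x)
𝟙-and p []       = refl
𝟙-and p (x ∷ xs) with p x
... | true  = trans (𝟙-and p xs) (sym (*-identityˡ _))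
... | false = sym (*-zeroˡ (∏[ y ← xs ] 𝟙 (p y)))

∑-allVec-suc : (xs : List X) (k : ℕ) (F : Vec X (suc k) → ℚ) →
               ∑ (allVec xs (suc k)) F ≡ ∑[ c ← xs ] ∑[ v ← allVec xs k ] F (c Vec.∷ v)
∑-allVec-suc xs k F = trans (∑-concatMap (λ c → map (c Vec.∷_) (allVec xs k)) xs F)
                            (∑-cong xs (λ c → ∑-map (c Vec.∷_) (allVec xs k) F))

∑-allVec-insertAt : (xs : List X) (k : ℕ) (b : Fin (suc k)) (F : Vec X (suc k) → ℚ) →
                    ∑ (allVec xs (suc k)) F ≡ ∑[ c ← xs ] ∑[ v ← allVec xs k ] F (insertAt v b c)
∑-allVec-insertAt xs k       zero    F = ∑-allVec-suc xs k F
∑-allVec-insertAt xs (suc k) (suc b) F = begin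
  ∑ (allVec xs (suc (suc k))) F
    ≡⟨ ∑-allVec-suc xs (suc k) F ⟩
  ∑[ d ← xs ] ∑[ v ← allVec xs (suc k) ] F (d Vec.∷ v)
    ≡⟨ ∑-cong xs (λ d → ∑-allVec-insertAt xs k b (F ∘ (d Vec.∷_))) ⟩
  ∑[ d ← xs ] ∑[ c ← xs ] ∑[ v ← allVec xs k ] F (d Vec.∷ insertAt v b c)
    ≡⟨ ∑-comm xs xs _ ⟩
  ∑[ c ← xs ] ∑[ d ← xs ] ∑[ v ← allVec xs k ] F (d Vec.∷ insertAt v b c)
    ≡⟨ ∑-cong xs (λ c → ∑-allVec-suc xs k (λ v → F (insertAt v (suc b) c))) ⟨
  ∑[ c ← xs ] ∑[ v ← allVec xs (suc k) ] F (insertAt v (suc b) c) ∎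

∑-allVec-∏ : (xs : List X) (as : List A) (φ : X × A → ℚ) →
             ∑[ v ← allVec xs (length as) ] ∏ (zip (toList v) as) φ ≡ ∏[ a ← as ] ∑[ x ← xs ] φ (x , a)
∑-allVec-∏ xs []       φ = refl
∑-allVec-∏ xs (a ∷ as) φ = begin
  ∑[ v ← allVec xs (suc (length as)) ] ∏ (zip (toList v) (a ∷ as)) φ
    ≡⟨ ∑-allVec-suc xs (length as) _ ⟩
  ∑[ x ← xs ] ∑[ v ← allVec xs (length as) ] (φ (x , a) * ∏ (zip (toList v) as) φ)
    ≡⟨ ∑-cong xs (λ x → *-distribˡ-∑ (φ (x , a)) (allVec xs (length as)) _) ⟨
  ∑[ x ← xs ] (φ (x , a) * ∑[ v ← allVec xs (length as) ] ∏ (zip (toList v) as) φ)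
    ≡⟨ *-distribʳ-∑ _ xs (λ x → φ (x , a)) ⟨
  ∑[ x ← xs ] φ (x , a) * ∑[ v ← allVec xs (length as) ] ∏ (zip (toList v) as) φ
    ≡⟨ cong (∑[ x ← xs ] φ (x , a) *_) (∑-allVec-∏ xs as φ) ⟩
  ∑[ x ← xs ] φ (x , a) * ∏[ a′ ← as ] ∑[ x ← xs ] φ (x , a′) ∎

∑-allFin-suc : (F : Fin (suc q) → ℚ) → ∑ (allFin (suc q)) F ≡ F zero + ∑ (allFin q) (F ∘ suc)
∑-allFin-suc {q} F =
  cong (F zero +_) (trans (cong (λ cs → ∑ cs F) (sym (map-tabulate id suc))) (∑-map suc (allFin q) F))

∑-δ : (d : Fin q) (X : Fin q → ℚ) → ∑[ c ← allFin q ] (𝟙 (toℕ d ≡ᵇ toℕ c) * X c) ≡ X d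
∑-δ {suc q} zero X = begin
  ∑[ c ← allFin (suc q) ] (𝟙 (0 ≡ᵇ toℕ c) * X c)
    ≡⟨ ∑-allFin-suc (λ c → 𝟙 (0 ≡ᵇ toℕ c) * X c) ⟩
  1ℚ * X zero + ∑[ c ← allFin q ] (0ℚ * X (suc c))
    ≡⟨ cong₂ _+_ (*-identityˡ (X zero))
                 (trans (sym (*-distribˡ-∑ 0ℚ (allFin q) (X ∘ suc))) (*-zeroˡ (∑ (allFin q) (X ∘ suc)))) ⟩
  X zero + 0ℚ
    ≡⟨ +-identityʳ (X zero) ⟩
  X zero ∎
∑-δ {suc q} (suc d) X = begin
  ∑[ c ← allFin (suc q) ] (𝟙 (toℕ (suc d) ≡ᵇ toℕ c) * X c)
    ≡⟨ ∑-allFin-suc (λ c → 𝟙 (toℕ (suc d) ≡ᵇ toℕ c) * X c) ⟩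
  0ℚ * X zero + ∑[ c ← allFin q ] (𝟙 (toℕ d ≡ᵇ toℕ c) * X (suc c))
    ≡⟨ cong₂ _+_ (*-zeroˡ (X zero)) (∑-δ d (X ∘ suc)) ⟩
  0ℚ + X (suc d)
    ≡⟨ +-identityˡ _ ⟩
  X (suc d) ∎

-- Colourings of quotient vertex sets

Arc : ℕ → Set
Arc k = Fin k × Fin k

onColours : (ℕ → ℕ → A) → (Fin k → Fin q) → Arc k → A
onColours t h (u , v) = t (toℕ (h u)) (toℕ (h v))

holds : (ℕ → ℕ → Bool) → (Fin k → Fin q) → Arc k → ℚ
holds _∼_ h a = 𝟙 (onColours _∼_ h a)

holds-ext : (_∼_ : ℕ → ℕ → Bool) {h h′ : Fin k → Fin q} → h ≗ h′ → holds _∼_ h ≗ holds _∼_ h′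
holds-ext _∼_ h≗h′ (u , v) = cong₂ (λ c d → 𝟙 (toℕ c ∼ toℕ d)) (h≗h′ u) (h≗h′ v)

-- A colouring of the merged vertex set is a colouring f of Fin (suc k) with f a = f b:
-- insert at b the colour of a.
∑-merge : (a b : Fin m) (a≢b : a ≢ b) (G : (Fin m → Fin q) → ℚ) → G Preserves _≗_ ⟶ _≡_ →
          ∑[ g ← colourings (proj₁ (merge a b a≢b)) q ] G (lookup g ∘ proj₂ (merge a b a≢b))
          ≡ ∑[ f ← colourings m q ] (holds _≡ᵇ_ (lookup f) (a , b) * G (lookup f))
∑-merge {suc k} {q} a b a≢b G G-ext = sym (begin
  ∑[ f ← colourings (suc k) q ] (holds _≡ᵇ_ (lookup f) (a , b) * G (lookup f))
    ≡⟨ ∑-allVec-insertAt (allFin q) k b _ ⟩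
  ∑[ c ← allFin q ] ∑[ g ← colourings k q ]
    (holds _≡ᵇ_ (lookup (insertAt g b c)) (a , b) * G (lookup (insertAt g b c)))
    ≡⟨ ∑-cong (allFin q) (λ c → ∑-cong (colourings k q) (λ g →
         cong₂ (λ s t → 𝟙 (toℕ s ≡ᵇ toℕ t) * G (lookup (insertAt g b c)))
               (lookup-a g c) (insertAt-lookup g b c))) ⟩
  ∑[ c ← allFin q ] ∑[ g ← colourings k q ] (𝟙 (toℕ (lookup g a′) ≡ᵇ toℕ c) * G (lookup (insertAt g b c)))
    ≡⟨ ∑-comm (allFin q) (colourings k q) _ ⟩
  ∑[ g ← colourings k q ] ∑[ c ← allFin q ] (𝟙 (toℕ (lookup g a′) ≡ᵇ toℕ c) * G (lookup (insertAt g b c)))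
    ≡⟨ ∑-cong (colourings k q) (λ g → ∑-δ (lookup g a′) (λ c → G (lookup (insertAt g b c)))) ⟩
  ∑[ g ← colourings k q ] G (lookup (insertAt g b (lookup g a′)))
    ≡⟨ ∑-cong (colourings k q) (λ g → G-ext (merged g)) ⟩
  ∑[ g ← colourings k q ] G (lookup g ∘ proj₂ (merge a b a≢b)) ∎)
  where
  a′ : Fin k
  a′ = punchOut (≢-sym a≢b)

  lookup-a : ∀ g c → lookup (insertAt g b c) a ≡ lookup g a′
  lookup-a g c = trans (cong (lookup (insertAt g b c)) (sym (punchIn-punchOut (≢-sym a≢b))))
                       (insertAt-punchIn g b c a′)

  merged : ∀ g → lookup (insertAt g b (lookup g a′)) ≗ lookup g ∘ proj₂ (merge a b a≢b)
  merged g w with b ≟ᶠ w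
  ... | yes refl = insertAt-lookup g b (lookup g a′)
  ... | no  b≢w  = trans (cong (lookup (insertAt g b (lookup g a′))) (sym (punchIn-punchOut b≢w)))
                         (insertAt-punchIn g b _ (punchOut b≢w))

-- π identifies the endpoints of the arcs rs and nothing else: colourings of its target, pulled
-- back along π, are the colourings that are constant on every arc of rs.
Contracts : (q : ℕ) → (Fin k → Fin m) → List (Arc k) → Set
Contracts {k} {m} q π rs = (F : (Fin k → Fin q) → ℚ) → F Preserves _≗_ ⟶ _≡_ →
  ∑[ g ← colourings m q ] F (lookup g ∘ π)
  ≡ ∑[ f ← colourings k q ] (∏ rs (holds _≡ᵇ_ (lookup f)) * F (lookup f))

contracts-∷ : {π : Fin k → Fin m} {rs : List (Arc k)} → Contracts q π rs → (u v : Fin k) →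
              (F : (Fin k → Fin q) → ℚ) → F Preserves _≗_ ⟶ _≡_ →
              ∑[ g ← colourings m q ] (holds _≡ᵇ_ (lookup g) (π u , π v) * F (lookup g ∘ π))
              ≡ ∑[ f ← colourings k q ] (∏ ((u , v) ∷ rs) (holds _≡ᵇ_ (lookup f)) * F (lookup f))
contracts-∷ {k} {q = q} {rs = rs} π-contracts u v F F-ext =
  trans (π-contracts (λ h → holds _≡ᵇ_ h (u , v) * F h)
                     (λ h≗h′ → cong₂ _*_ (holds-ext _≡ᵇ_ h≗h′ (u , v)) (F-ext h≗h′)))
        (∑-cong (colourings k q) (λ f →
          x∙yz≈yx∙z (∏ rs (holds _≡ᵇ_ (lookup f))) (holds _≡ᵇ_ (lookup f) (u , v)) (F (lookup f))))

contracts-loop : {π : Fin k → Fin m} {rs : List (Arc k)} {u v : Fin k} →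
                 π u ≡ π v → Contracts q π rs → Contracts q π ((u , v) ∷ rs)
contracts-loop {m = m} {q} {π} {rs} {u} {v} πu≡πv π-contracts F F-ext =
  trans (∑-cong (colourings m q) (λ g → sym (loop-weight g)))
        (contracts-∷ {π = π} {rs = rs} π-contracts u v F F-ext)
  where
  ≡ᵇ-refl : ∀ n → (n ≡ᵇ n) ≡ true
  ≡ᵇ-refl zero    = refl
  ≡ᵇ-refl (suc n) = ≡ᵇ-refl n

  loop-weight : ∀ g → holds _≡ᵇ_ (lookup g) (π u , π v) * F (lookup g ∘ π) ≡ F (lookup g ∘ π)
  loop-weight g = begin
    holds _≡ᵇ_ (lookup g) (π u , π v) * F (lookup g ∘ π)
      ≡⟨ cong (λ w → holds _≡ᵇ_ (lookup g) (π u , w) * F (lookup g ∘ π)) πu≡πv ⟨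
    holds _≡ᵇ_ (lookup g) (π u , π u) * F (lookup g ∘ π)
      ≡⟨ cong (λ b → 𝟙 b * F (lookup g ∘ π)) (≡ᵇ-refl (toℕ (lookup g (π u)))) ⟩
    1ℚ * F (lookup g ∘ π)
      ≡⟨ *-identityˡ _ ⟩
    F (lookup g ∘ π) ∎

contracts-merge : {π : Fin k → Fin m} {rs : List (Arc k)} {u v : Fin k} (πu≢πv : π u ≢ π v) →
                  Contracts q π rs → Contracts q (proj₂ (merge (π u) (π v) πu≢πv) ∘ π) ((u , v) ∷ rs)
contracts-merge {π = π} {rs} {u} {v} πu≢πv π-contracts F F-ext =
  trans (∑-merge (π u) (π v) πu≢πv (λ h → F (h ∘ π)) (λ h≗h′ → F-ext (h≗h′ ∘ π)))
        (contracts-∷ {π = π} {rs = rs} π-contracts u v F F-ext)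

quot-contracts : (rs : List (Arc k)) → Contracts q (proj₂ (quot k rs)) rs
quot-contracts {k} {q} [] F F-ext = ∑-cong (colourings k q) (λ f → sym (*-identityˡ _))
quot-contracts {k} ((u , v) ∷ rs) with quot k rs | quot-contracts rs
... | m , π | π-contracts with π u ≟ᶠ π v
...   | yes πu≡πv = contracts-loop {rs = rs} πu≡πv π-contracts
...   | no  πu≢πv = contracts-merge {rs = rs} πu≢πv π-contracts

-- Chromatic counts as sums over colourings

χ[_] : (ℕ → ℕ → Bool) → Digraph → ℕ → ℕ
χ[ _∼_ ] D q = count (λ f → and (map (onColours _∼_ (lookup f)) (arcs D))) (colourings (n D) q)

deleting : (ℕ → ℕ → Bool) → (Fin k → Fin q) → Lab × Arc k → ℚ
deleting _∼_ h (R , a) = 1ℚ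
deleting _∼_ h (S , a) = holds _∼_ h a
deleting _∼_ h (T , a) = holds _∼_ h (swap a)

contracting : (ℕ → ℕ → Bool) → (Fin k → Fin q) → Lab × Arc k → ℚ
contracting _∼_ h (R , a) = holds _≡ᵇ_ h a
contracting _∼_ h (S , a) = holds _∼_ h a
contracting _∼_ h (T , a) = holds _∼_ h (swap a)

deleting-ext : (_∼_ : ℕ → ℕ → Bool) {h h′ : Fin k → Fin q} → h ≗ h′ → deleting _∼_ h ≗ deleting _∼_ h′
deleting-ext _∼_ h≗h′ (R , a) = refl
deleting-ext _∼_ h≗h′ (S , a) = holds-ext _∼_ h≗h′ a
deleting-ext _∼_ h≗h′ (T , a) = holds-ext _∼_ h≗h′ (swap a)

∏-orient : (_∼_ : ℕ → ℕ → Bool) (π : Fin k → Fin m) (h : Fin m → Fin q) (L : List (Lab × Arc k)) →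
           ∏ (orient π L) (holds _∼_ h) ≡ ∏ L (deleting _∼_ (h ∘ π))
∏-orient _∼_ π h []                  = refl
∏-orient _∼_ π h ((R , u , v) ∷ L) = trans (∏-orient _∼_ π h L) (sym (*-identityˡ _))
∏-orient _∼_ π h ((S , u , v) ∷ L) = cong (holds _∼_ h (π u , π v) *_) (∏-orient _∼_ π h L)
∏-orient _∼_ π h ((T , u , v) ∷ L) = cong (holds _∼_ h (π v , π u) *_) (∏-orient _∼_ π h L)

∏-rArcs : (_∼_ : ℕ → ℕ → Bool) (h : Fin k → Fin q) (L : List (Lab × Arc k)) →
          ∏ (rArcs L) (holds _≡ᵇ_ h) * ∏ L (deleting _∼_ h) ≡ ∏ L (contracting _∼_ h)
∏-rArcs _∼_ h []            = refl
∏-rArcs _∼_ h ((R , a) ∷ L) = begin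
  holds _≡ᵇ_ h a * ∏ (rArcs L) (holds _≡ᵇ_ h) * (1ℚ * ∏ L (deleting _∼_ h))
    ≡⟨ cong (holds _≡ᵇ_ h a * ∏ (rArcs L) (holds _≡ᵇ_ h) *_) (*-identityˡ _) ⟩
  holds _≡ᵇ_ h a * ∏ (rArcs L) (holds _≡ᵇ_ h) * ∏ L (deleting _∼_ h)
    ≡⟨ *-assoc (holds _≡ᵇ_ h a) _ _ ⟩
  holds _≡ᵇ_ h a * (∏ (rArcs L) (holds _≡ᵇ_ h) * ∏ L (deleting _∼_ h))
    ≡⟨ cong (holds _≡ᵇ_ h a *_) (∏-rArcs _∼_ h L) ⟩
  holds _≡ᵇ_ h a * ∏ L (contracting _∼_ h) ∎
∏-rArcs _∼_ h ((S , a) ∷ L) =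
  trans (x∙yz≈y∙xz (∏ (rArcs L) (holds _≡ᵇ_ h)) (holds _∼_ h a) _) (cong (holds _∼_ h a *_) (∏-rArcs _∼_ h L))
∏-rArcs _∼_ h ((T , a) ∷ L) =
  trans (x∙yz≈y∙xz (∏ (rArcs L) (holds _≡ᵇ_ h)) (holds _∼_ h (swap a)) _)
        (cong (holds _∼_ h (swap a) *_) (∏-rArcs _∼_ h L))

χ-orient : (_∼_ : ℕ → ℕ → Bool) (π : Fin k → Fin m) (L : List (Lab × Arc k)) (q : ℕ) →
           ℕ→ℚ (χ[ _∼_ ] (digraph m (orient π L)) q)
           ≡ ∑[ g ← colourings m q ] ∏ L (deleting _∼_ (lookup g ∘ π))
χ-orient {m = m} _∼_ π L q = trans (ℕ→ℚ-count _ (colourings m q)) (∑-cong (colourings m q) (λ g →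
  trans (𝟙-and (onColours _∼_ (lookup g)) (orient π L)) (∏-orient _∼_ π (lookup g) L)))

χ-delRev : (_∼_ : ℕ → ℕ → Bool) (D : Digraph) (q : ℕ) (ls : Vec Lab (length (arcs D))) →
           ℕ→ℚ (χ[ _∼_ ] (delRev D ls) q)
           ≡ ∑[ f ← colourings (n D) q ] ∏ (labelled D ls) (deleting _∼_ (lookup f))
χ-delRev _∼_ D q ls = χ-orient _∼_ id (labelled D ls) q

χ-conRev : (_∼_ : ℕ → ℕ → Bool) (D : Digraph) (q : ℕ) (ls : Vec Lab (length (arcs D))) →
           ℕ→ℚ (χ[ _∼_ ] (conRev D ls) q)
           ≡ ∑[ f ← colourings (n D) q ] ∏ (labelled D ls) (contracting _∼_ (lookup f))
χ-conRev _∼_ D q ls with quot (n D) (rArcs (labelled D ls)) | quot-contracts {q = q} (rArcs (labelled D ls))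
... | m , π | π-contracts = begin
  ℕ→ℚ (χ[ _∼_ ] (digraph m (orient π L)) q)
    ≡⟨ χ-orient _∼_ π L q ⟩
  ∑[ g ← colourings m q ] ∏ L (deleting _∼_ (lookup g ∘ π))
    ≡⟨ π-contracts (λ h → ∏ L (deleting _∼_ h)) (λ h≗h′ → ∏-cong L (deleting-ext _∼_ h≗h′)) ⟩
  ∑[ f ← colourings (n D) q ] (∏ (rArcs L) (holds _≡ᵇ_ (lookup f)) * ∏ L (deleting _∼_ (lookup f)))
    ≡⟨ ∑-cong (colourings (n D) q) (λ f → ∏-rArcs _∼_ (lookup f) L) ⟩
  ∑[ f ← colourings (n D) q ] ∏ L (contracting _∼_ (lookup f)) ∎
  where
  L : List (Lab × Arc (n D))
  L = labelled D ls

-- Expansion over the partitions R ⊎ S ⊎ T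

labelWeight : ℚ → ℚ → Lab → ℚ
labelWeight y z R = 1ℚ
labelWeight y z S = y
labelWeight y z T = z

arcSum : ℚ → ℚ → (Lab × A → ℚ) → A → ℚ
arcSum y z φ a = φ (R , a) + y * φ (S , a) + z * φ (T , a)

labelWeights : ℚ → ℚ → List (Lab × A) → ℚ
labelWeights y z L = (y ^ numLab S L) * (z ^ numLab T L)

labelWeights-∏ : (y z : ℚ) (L : List (Lab × A)) → labelWeights y z L ≡ ∏[ e ← L ] labelWeight y z (proj₁ e)
labelWeights-∏ y z []            = refl
labelWeights-∏ y z ((R , a) ∷ L) = trans (labelWeights-∏ y z L) (sym (*-identityˡ _))
labelWeights-∏ y z ((S , a) ∷ L) = trans (*-assoc y _ _) (cong (y *_) (labelWeights-∏ y z L))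
labelWeights-∏ y z ((T , a) ∷ L) =
  trans (x∙yz≈y∙xz (y ^ numLab S L) z (z ^ numLab T L)) (cong (z *_) (labelWeights-∏ y z L))

∑-partitions : (y z : ℚ) (as : List A) (φ : Lab × A → ℚ) →
               ∑[ ls ← partitions (length as) ]
                 (labelWeights y z (zip (toList ls) as) * ∏ (zip (toList ls) as) φ)
               ≡ ∏ as (arcSum y z φ)
∑-partitions y z as φ = begin
  ∑[ ls ← partitions (length as) ] (labelWeights y z (zip (toList ls) as) * ∏ (zip (toList ls) as) φ)
    ≡⟨ ∑-cong (partitions (length as)) (λ ls →
         trans (cong (_* ∏ (zip (toList ls) as) φ) (labelWeights-∏ y z (zip (toList ls) as)))
               (∏-distrib-* (zip (toList ls) as) _ φ)) ⟩
  ∑[ ls ← partitions (length as) ] ∏[ e ← zip (toList ls) as ] (labelWeight y z (proj₁ e) * φ e)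
    ≡⟨ ∑-allVec-∏ (R ∷ S ∷ T ∷ []) as _ ⟩
  ∏[ a ← as ] ∑[ l ← R ∷ S ∷ T ∷ [] ] (labelWeight y z l * φ (l , a))
    ≡⟨ ∏-cong as sum-over-labels ⟩
  ∏ as (arcSum y z φ) ∎
  where
  sum-over-labels : ∀ a → ∑[ l ← R ∷ S ∷ T ∷ [] ] (labelWeight y z l * φ (l , a)) ≡ arcSum y z φ a
  sum-over-labels a = begin
    1ℚ * φ (R , a) + (y * φ (S , a) + (z * φ (T , a) + 0ℚ))
      ≡⟨ cong₂ _+_ (*-identityˡ (φ (R , a))) (cong (y * φ (S , a) +_) (+-identityʳ (z * φ (T , a)))) ⟩
    φ (R , a) + (y * φ (S , a) + z * φ (T , a))
      ≡⟨ +-assoc (φ (R , a)) _ _ ⟨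
    arcSum y z φ a ∎

partSum-expansion : (D : Digraph) (y z : ℚ) (C : List X) (φ : X → Lab × Arc (n D) → ℚ)
                    {Φ : Vec Lab (length (arcs D)) → ℚ} →
                    (∀ ls → Φ ls ≡ ∑[ f ← C ] ∏ (labelled D ls) (φ f)) →
                    partSum D y z Φ ≡ ∑[ f ← C ] ∏ (arcs D) (arcSum y z (φ f))
partSum-expansion D y z C φ {Φ} Φ-expansion = begin
  partSum D y z Φ
    ≡⟨ ∑-cong parts (λ ls → cong (labelWeights y z (labelled D ls) *_) (Φ-expansion ls)) ⟩
  ∑[ ls ← parts ] (labelWeights y z (labelled D ls) * ∑[ f ← C ] ∏ (labelled D ls) (φ f))
    ≡⟨ ∑-cong parts (λ ls → *-distribˡ-∑ (labelWeights y z (labelled D ls)) C _) ⟩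
  ∑[ ls ← parts ] ∑[ f ← C ] (labelWeights y z (labelled D ls) * ∏ (labelled D ls) (φ f))
    ≡⟨ ∑-comm parts C _ ⟩
  ∑[ f ← C ] ∑[ ls ← parts ] (labelWeights y z (labelled D ls) * ∏ (labelled D ls) (φ f))
    ≡⟨ ∑-cong C (λ f → ∑-partitions y z (arcs D) (φ f)) ⟩
  ∑[ f ← C ] ∏ (arcs D) (arcSum y z (φ f)) ∎
  where
  parts : List (Vec Lab (length (arcs D)))
  parts = partitions (length (arcs D))

colourSum : Digraph → ℕ → (ℕ → ℕ → ℚ) → ℚ
colourSum D q t = ∑[ f ← colourings (n D) q ] ∏ (arcs D) (onColours t (lookup f))

module _ (D : Digraph) (q : ℕ) (y z : ℚ) (_∼_ : ℕ → ℕ → Bool) (t : ℕ → ℕ → ℚ) where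

  partSum-deletion : (∀ x w → 1ℚ + y * 𝟙 (x ∼ w) + z * 𝟙 (w ∼ x) ≡ t x w) →
                     partSum D y z (λ ls → ℕ→ℚ (χ[ _∼_ ] (delRev D ls) q)) ≡ colourSum D q t
  partSum-deletion arc-rule =
    trans (partSum-expansion D y z (colourings (n D) q) (deleting _∼_ ∘ lookup) (χ-delRev _∼_ D q))
          (∑-cong (colourings (n D) q) (λ f → ∏-cong (arcs D) (λ (u , v) → arc-rule _ _)))

  partSum-contraction : (∀ x w → 𝟙 (x ≡ᵇ w) + y * 𝟙 (x ∼ w) + z * 𝟙 (w ∼ x) ≡ t x w) →
                        partSum D y z (λ ls → ℕ→ℚ (χ[ _∼_ ] (conRev D ls) q)) ≡ colourSum D q t
  partSum-contraction arc-rule =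
    trans (partSum-expansion D y z (colourings (n D) q) (contracting _∼_ ∘ lookup) (χ-conRev _∼_ D q))
          (∑-cong (colourings (n D) q) (λ f → ∏-cong (arcs D) (λ (u , v) → arc-rule _ _)))

-- Arc factors and the B-polynomial

ℚ-ring : ACR.AlmostCommutativeRing 0ℓ 0ℓ
ℚ-ring = ACR.fromCommutativeRing +-*-commutativeRing (λ x → dec⇒maybe (0ℚ ≟ x))

data Comparisonᵇ : Bool → Bool → Bool → Set where
  less    : Comparisonᵇ true  false false
  equal   : Comparisonᵇ false true  false
  greater : Comparisonᵇ false false true

compareᵇ : ∀ x w → Comparisonᵇ (x <ᵇ w) (x ≡ᵇ w) (w <ᵇ x)
compareᵇ zero    zero    = equal
compareᵇ zero    (suc w) = less
compareᵇ (suc x) zero    = greater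
compareᵇ (suc x) (suc w) = compareᵇ x w

≤ᵇ-as-<ᵇ : ∀ x w → (x ≤ᵇ w) ≡ not (w <ᵇ x)
≤ᵇ-as-<ᵇ zero    w       = refl
≤ᵇ-as-<ᵇ (suc x) zero    = refl
≤ᵇ-as-<ᵇ (suc x) (suc w) = trans (<ᵇ-suc x w) (≤ᵇ-as-<ᵇ x w)
  where
  <ᵇ-suc : ∀ x w → (x <ᵇ suc w) ≡ (x ≤ᵇ w)
  <ᵇ-suc zero    w = refl
  <ᵇ-suc (suc x) w = refl

trichotomy : ℚ → ℚ → ℚ → ℕ → ℕ → ℚ
trichotomy l e g x w = 𝟙 (x <ᵇ w) * l + 𝟙 (x ≡ᵇ w) * e + 𝟙 (w <ᵇ x) * g

-- In each proof below, abstracting the three comparisons and matching on compareᵇ turns the goal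
-- into a polynomial identity with constant indicators, which the ring solver decides.

<-deletion : ∀ y z x w → 1ℚ + y * 𝟙 (x <ᵇ w) + z * 𝟙 (w <ᵇ x) ≡ trichotomy (1ℚ + y) 1ℚ (1ℚ + z) x w
<-deletion y z x w with x <ᵇ w | x ≡ᵇ w | w <ᵇ x | compareᵇ x w
... | _ | _ | _ | less    = solve (y ∷ z ∷ []) ℚ-ring
... | _ | _ | _ | equal   = solve (y ∷ z ∷ []) ℚ-ring
... | _ | _ | _ | greater = solve (y ∷ z ∷ []) ℚ-ring

≤-deletion : ∀ y z x w →
             1ℚ + y * 𝟙 (x ≤ᵇ w) + z * 𝟙 (w ≤ᵇ x) ≡ trichotomy (1ℚ + y) (1ℚ + y + z) (1ℚ + z) x w
≤-deletion y z x w rewrite ≤ᵇ-as-<ᵇ x w | ≤ᵇ-as-<ᵇ w x with x <ᵇ w | x ≡ᵇ w | w <ᵇ x | compareᵇ x w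
... | _ | _ | _ | less    = solve (y ∷ z ∷ []) ℚ-ring
... | _ | _ | _ | equal   = solve (y ∷ z ∷ []) ℚ-ring
... | _ | _ | _ | greater = solve (y ∷ z ∷ []) ℚ-ring

<-contraction : ∀ y z x w → 𝟙 (x ≡ᵇ w) + y * 𝟙 (x <ᵇ w) + z * 𝟙 (w <ᵇ x) ≡ trichotomy y 1ℚ z x w
<-contraction y z x w with x <ᵇ w | x ≡ᵇ w | w <ᵇ x | compareᵇ x w
... | _ | _ | _ | less    = solve (y ∷ z ∷ []) ℚ-ring
... | _ | _ | _ | equal   = solve (y ∷ z ∷ []) ℚ-ring
... | _ | _ | _ | greater = solve (y ∷ z ∷ []) ℚ-ring

≤-contraction : ∀ y z x w →
                𝟙 (x ≡ᵇ w) + y * 𝟙 (x ≤ᵇ w) + z * 𝟙 (w ≤ᵇ x) ≡ trichotomy y (1ℚ + y + z) z x w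
≤-contraction y z x w rewrite ≤ᵇ-as-<ᵇ x w | ≤ᵇ-as-<ᵇ w x with x <ᵇ w | x ≡ᵇ w | w <ᵇ x | compareᵇ x w
... | _ | _ | _ | less    = solve (y ∷ z ∷ []) ℚ-ring
... | _ | _ | _ | equal   = solve (y ∷ z ∷ []) ℚ-ring
... | _ | _ | _ | greater = solve (y ∷ z ∷ []) ℚ-ring

_^ᵇ_ : ℚ → Bool → ℚ
p ^ᵇ b = 𝟙 b * p + 𝟙 (not b)

trichotomy-^ᵇ : ∀ p r x w → trichotomy p 1ℚ r x w ≡ (p ^ᵇ (x <ᵇ w)) * (r ^ᵇ (w <ᵇ x))
trichotomy-^ᵇ p r x w with x <ᵇ w | x ≡ᵇ w | w <ᵇ x | compareᵇ x w
... | _ | _ | _ | less    = solve (p ∷ r ∷ []) ℚ-ring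
... | _ | _ | _ | equal   = solve (p ∷ r ∷ []) ℚ-ring
... | _ | _ | _ | greater = solve (p ∷ r ∷ []) ℚ-ring

*-trichotomy : ∀ c l g x w → c * trichotomy l 1ℚ g x w ≡ trichotomy (c * l) c (c * g) x w
*-trichotomy c l g x w with x <ᵇ w | x ≡ᵇ w | w <ᵇ x | compareᵇ x w
... | _ | _ | _ | less    = solve (c ∷ l ∷ g ∷ []) ℚ-ring
... | _ | _ | _ | equal   = solve (c ∷ l ∷ g ∷ []) ℚ-ring
... | _ | _ | _ | greater = solve (c ∷ l ∷ g ∷ []) ℚ-ring

^ᵇ-*-^ : ∀ p b n → (p ^ᵇ b) * p ^ n ≡ p ^ ((if b then 1 else 0) ℕ.+ n)
^ᵇ-*-^ p true  n = cong (_* p ^ n) (trans (+-identityʳ _) (*-identityˡ p))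
^ᵇ-*-^ p false n =
  trans (cong (_* p ^ n) (trans (cong (_+ 1ℚ) (*-zeroˡ p)) (+-identityˡ 1ℚ))) (*-identityˡ (p ^ n))

∏-trichotomy : (p r : ℚ) (h : Fin k → Fin q) (as : List (Arc k)) →
               ∏ as (onColours (trichotomy p 1ℚ r) h)
               ≡ p ^ count (onColours _<ᵇ_ h) as * r ^ count (onColours (flip _<ᵇ_) h) as
∏-trichotomy p r h []       = refl
∏-trichotomy p r h (a ∷ as) = begin
  onColours (trichotomy p 1ℚ r) h a * ∏ as (onColours (trichotomy p 1ℚ r) h)
    ≡⟨ cong₂ _*_ (trichotomy-^ᵇ p r (toℕ (h (proj₁ a))) (toℕ (h (proj₂ a)))) (∏-trichotomy p r h as) ⟩
  (p ^ᵇ up) * (r ^ᵇ down) * (p ^ ascents * r ^ descents)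
    ≡⟨ *-interchange (p ^ᵇ up) (r ^ᵇ down) (p ^ ascents) (r ^ descents) ⟩
  (p ^ᵇ up) * p ^ ascents * ((r ^ᵇ down) * r ^ descents)
    ≡⟨ cong₂ _*_ (^ᵇ-*-^ p up ascents) (^ᵇ-*-^ r down descents) ⟩
  p ^ count (onColours _<ᵇ_ h) (a ∷ as) * r ^ count (onColours (flip _<ᵇ_) h) (a ∷ as) ∎
  where
  up down : Bool
  up   = onColours _<ᵇ_ h a
  down = onColours (flip _<ᵇ_) h a

  ascents descents : ℕ
  ascents  = count (onColours _<ᵇ_ h) as
  descents = count (onColours (flip _<ᵇ_) h) as

B-colourSum : (D : Digraph) (q : ℕ) (p r : ℚ) → B D q p r ≡ colourSum D q (trichotomy p 1ℚ r)
B-colourSum D q p r = ∑-cong (colourings (n D) q) (λ f → sym (∏-trichotomy p r (lookup f) (arcs D)))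

colourSum-scale : (D : Digraph) (q : ℕ) (l c g : ℚ) .{{_ : NonZero c}} →
                  colourSum D q (trichotomy l c g) ≡ c ^ length (arcs D) * B D q (l ÷ c) (g ÷ c)
colourSum-scale D q l c g = begin
  colourSum D q (trichotomy l c g)
    ≡⟨ ∑-cong cols (λ f → ∏-cong (arcs D) (λ (u , v) → sym (rescale (toℕ (lookup f u)) (toℕ (lookup f v))))) ⟩
  ∑[ f ← cols ] ∏[ a ← arcs D ] (c * onColours (trichotomy (l ÷ c) 1ℚ (g ÷ c)) (lookup f) a)
    ≡⟨ ∑-cong cols (λ f → ∏-scale c (arcs D) (onColours (trichotomy (l ÷ c) 1ℚ (g ÷ c)) (lookup f))) ⟩
  ∑[ f ← cols ] (c ^ length (arcs D) * ∏ (arcs D) (onColours (trichotomy (l ÷ c) 1ℚ (g ÷ c)) (lookup f)))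
    ≡⟨ *-distribˡ-∑ (c ^ length (arcs D)) cols _ ⟨
  c ^ length (arcs D) * colourSum D q (trichotomy (l ÷ c) 1ℚ (g ÷ c))
    ≡⟨ cong (c ^ length (arcs D) *_) (B-colourSum D q (l ÷ c) (g ÷ c)) ⟨
  c ^ length (arcs D) * B D q (l ÷ c) (g ÷ c) ∎
  where
  cols : List (Vec (Fin q) (n D))
  cols = colourings (n D) q

  *-÷ : ∀ a → c * (a ÷ c) ≡ a
  *-÷ a = trans (x∙yz≈y∙xz c a (1/ c)) (trans (cong (a *_) (*-inverseʳ c)) (*-identityʳ a))

  rescale : ∀ x w → c * trichotomy (l ÷ c) 1ℚ (g ÷ c) x w ≡ trichotomy l c g x w
  rescale x w = trans (*-trichotomy c (l ÷ c) (g ÷ c) x w)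
                      (cong₂ (λ l′ g′ → trichotomy l′ c g′ x w) (*-÷ l) (*-÷ g))

-- The identities hold for q = 0 as well.
theorem5p5 : (D : Digraph) (q : ℕ) → q ≥ 1 → (y z : ℚ) → (nz : ¬ (1ℚ + y + z ≡ 0ℚ)) →
      (partSum D y z (λ ls → ℕ→ℚ (χ> (delRev D ls) q)) ≡ B D q (1ℚ + y) (1ℚ + z))
    × (partSum D y z (λ ls → ℕ→ℚ (χ≥ (delRev D ls) q))
        ≡ ((1ℚ + y + z) ^ length (arcs D))
          * B D q (_÷_ (1ℚ + y) (1ℚ + y + z) {{≢-nonZero nz}}) (_÷_ (1ℚ + z) (1ℚ + y + z) {{≢-nonZero nz}}))
    × (partSum D y z (λ ls → ℕ→ℚ (χ> (conRev D ls) q)) ≡ B D q y z)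
    × (partSum D y z (λ ls → ℕ→ℚ (χ≥ (conRev D ls) q))
        ≡ ((1ℚ + y + z) ^ length (arcs D))
          * B D q (_÷_ y (1ℚ + y + z) {{≢-nonZero nz}}) (_÷_ z (1ℚ + y + z) {{≢-nonZero nz}}))
theorem5p5 D q _ y z nz =
    trans (partSum-deletion D q y z _<ᵇ_ _ (<-deletion y z)) (sym (B-colourSum D q (1ℚ + y) (1ℚ + z)))
  , trans (partSum-deletion D q y z _≤ᵇ_ _ (≤-deletion y z)) (colourSum-scale D q _ _ _)
  , trans (partSum-contraction D q y z _<ᵇ_ _ (<-contraction y z)) (sym (B-colourSum D q y z))
  , trans (partSum-contraction D q y z _≤ᵇ_ _ (≤-contraction y z)) (colourSum-scale D q _ _ _)
  where
  instance
    1+y+z≢0 : NonZero (1ℚ + y + z)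
    1+y+z≢0 = ≢-nonZero nz
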